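{- Let $k\ge 2$ and $1\leq \ell\leq k-1$. Then \[ F_{k,\ell}(x)=\ell x\, G_{k,\ell}(x)+x^\ell, \] where $F_{k,\ell}(x)=\sum_{n\ge0}\#\mathcal{P}_{k,\ell}(n)x^n$ and $G_{k,\ell}(x)=\sum_{i\ge \ell}F_{k,i}(x)$.
   Context: A set partition of $[n]=\{1,\dots,n\}$ is identified with its canonical sequential form $\pi_1\cdots\pi_n$: list blocks in increasing order of their minima and set $\pi_i=m$ iff $i$ lies in the $m$-th block. A partition avoids a word $\tau$ if no subsequence of $\pi$ has the same reduced form (relabeling the distinct letters order-preservingly by $1,2,\dots$) as $\tau$. $\mathcal{P}_k(n)$ is the set of partitions of $[n]$ avoiding $12\cdots k12$. A partition $\pi$ of $[n]$ is $\ell$-increasing if $n\ge \ell$, $\pi_i=i$ for $i=1,\dots,\ell$, and (when $n>\ell$) $\pi_{\ell+1}\neq \ell+1$; thus the empty partition is the only $0$-increasing one. $\mathcal{P}_{k,\ell}(n)$ is the set of $\ell$-increasing partitions in $\mathcal{P}_k(n)$. -}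

module Defs where

open import Data.Bool using (Bool; true; false; _∧_; _∨_; not; if_then_else_)
open import Data.Nat using (ℕ; zero; suc; _+_; _*_; _∸_; _≤ᵇ_; _<ᵇ_; _≡ᵇ_; _⊔_)
open import Data.List using (List; []; _∷_; _++_; map; length; concatMap; upTo; filterᵇ; take; drop)
open import Data.Bool.ListAction using (any)
open import Data.Nat.ListAction using (sum)

eqList : List ℕ → List ℕ → Bool
eqList []       []       = true
eqList (a ∷ as) (b ∷ bs) = (a ≡ᵇ b) ∧ eqList as bs
eqList _        _        = false

oneTo : ℕ → List ℕ
oneTo m = map suc (upTo m)

words : ℕ → ℕ → List (List ℕ)
words zero    m = [] ∷ []
words (suc n) m = concatMap (λ a → map (a ∷_) (words n m)) (oneTo m)

-- Canonical sequential form of a set partition (restricted growth word):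
-- π₁ = 1 and each letter is at most 1 + (maximum of the previous letters), letters ≥ 1.
isCanonicalFrom : ℕ → List ℕ → Bool
isCanonicalFrom mx []       = true
isCanonicalFrom mx (a ∷ as) = (1 ≤ᵇ a) ∧ (a ≤ᵇ suc mx) ∧ isCanonicalFrom (mx ⊔ a) as

isCanonical : List ℕ → Bool
isCanonical = isCanonicalFrom 0

subseqs : List ℕ → List (List ℕ)
subseqs []       = [] ∷ []
subseqs (x ∷ xs) = map (x ∷_) (subseqs xs) ++ subseqs xs

-- Reduced form: replace each letter a by 1 + (number of distinct letters of s smaller than a).
occurs : ℕ → List ℕ → Bool
occurs b s = any (λ c → b ≡ᵇ c) s

reduce : List ℕ → List ℕ
reduce s = map (λ a → suc (length (filterᵇ (λ b → occurs b s) (upTo a)))) s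

contains : List ℕ → List ℕ → Bool
contains π τ = any (λ σ → eqList (reduce σ) τ) (subseqs π)

pat : ℕ → List ℕ
pat k = oneTo k ++ (1 ∷ 2 ∷ [])

isIncreasing : ℕ → List ℕ → Bool
isIncreasing ℓ π = (ℓ ≤ᵇ length π) ∧ eqList (take ℓ π) (oneTo ℓ) ∧ rest (drop ℓ π)
  where
  rest : List ℕ → Bool
  rest []      = true
  rest (a ∷ _) = not (a ≡ᵇ suc ℓ)

-- #P_{k,ℓ}(n): canonical forms of partitions of [n] (all entries lie in {1..n})
-- that avoid 12⋯k12 and are ℓ-increasing.
countP : ℕ → ℕ → ℕ → ℕ
countP k ℓ n =
  length (filterᵇ (λ π → isCanonical π ∧ not (contains π (pat k)) ∧ isIncreasing ℓ π) (words n n))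

Series : Set
Series = ℕ → ℕ

_⊕_ : Series → Series → Series
(f ⊕ g) n = f n + g n

_·ₛ_ : ℕ → Series → Series
(c ·ₛ f) n = c * f n

X* : Series → Series
X* f zero    = 0
X* f (suc n) = f n

Xpow : ℕ → Series
Xpow ℓ n = if n ≡ᵇ ℓ then 1 else 0

F : ℕ → ℕ → Series
F k ℓ n = countP k ℓ n

-- G_{k,ℓ}(x) = Σ_{i ≥ ℓ} F_{k,i}(x).  Coefficient of x^n: Σ_{i ≥ ℓ} #P_{k,i}(n);
-- terms with i > n vanish (ℓ-increasing requires n ≥ ℓ), so the sum is over ℓ ≤ i ≤ n.
G : ℕ → ℕ → Series
G k ℓ n = sum (map (λ i → if ℓ ≤ᵇ i then F k i n else 0) (upTo (suc n)))

-- An ℓ-increasing partition of [n+1] avoiding 12⋯k12 has the form 12⋯ℓ a σ with a ≤ ℓ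
-- (a = ℓ+1 is excluded by ℓ-increasingness, a > ℓ+1 by canonicity). Since ℓ < k, deleting
-- the letter a neither creates nor destroys an occurrence of 12⋯k12: in an occurrence that
-- uses this a, the letters before it have smaller ranks, hence are smaller than a, so the
-- copy of a inside the prefix 12⋯ℓ can be used instead. Deletion is therefore an ℓ-to-one
-- map onto the avoiding partitions of [n] beginning with 12⋯ℓ, and these are counted by
-- Σ_{i ≥ ℓ} #P_{k,i}(n), the coefficient of x^n in G_{k,ℓ}. The only ℓ-increasing
-- partition of [ℓ] is 12⋯ℓ itself, which gives the term x^ℓ.

module Submission where

open import Defs
open import Data.Bool using (Bool; true; false; _∧_; not; if_then_else_)
open import Data.Bool.Properties using (T-≡; ¬-not; ∧-identityʳ; ∧-zeroʳ; ⇔→≡)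
open import Data.Empty using (⊥-elim)
open import Data.Nat
open import Data.Nat.Properties
open import Data.Nat.ListAction using (sum)
open import Algebra.Properties.CommutativeSemigroup +-commutativeSemigroup using (interchange)
open import Data.List using (List; []; _∷_; _++_; [_]; map; length; upTo; applyUpTo; take; drop; filterᵇ; concat)
open import Data.List.Properties
  using (∷-injective; ∷-injectiveˡ; ∷-injectiveʳ; length-++; length-map; length-applyUpTo; map-++; map-∘;
         map-upTo; map-applyUpTo; upTo-∷ʳ; ++-assoc; take++drop≡id; filter-++)
open import Data.List.Membership.Propositional using (_∈_; find; lose)
open import Data.List.Membership.Propositional.Properties
  using (∈-map⁺; ∈-map⁻; ∈-++⁺ˡ; ∈-++⁺ʳ; ∈-++⁻; ∈-applyUpTo⁺)
open import Data.List.Relation.Binary.Sublist.Propositional {A = ℕ}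
  using (_⊆_; []; _∷_; _∷ʳ_; ⊆-refl; ⊆-trans; minimum; lookup)
open import Data.List.Relation.Binary.Sublist.Propositional.Properties using (++⁺; ++⁺ʳ; length-mono-≤; filter⁺)
open import Data.List.Relation.Unary.All using (All; []; _∷_)
import Data.List.Relation.Unary.All as All
import Data.List.Relation.Unary.All.Properties as All
open import Data.List.Relation.Unary.AllPairs using (AllPairs; []; _∷_)
import Data.List.Relation.Unary.AllPairs.Properties as AllPairs
open import Data.List.Relation.Unary.Any using (here; there)
open import Data.List.Relation.Unary.Any.Properties using (any⁺; any⁻)
open import Data.Product using (∃₂; ∃-syntax; _×_; _,_; proj₂)
open import Data.Sum using (inj₁; inj₂)
open import Function using (id; _∘_; Equivalence; mk⇔)
open import Relation.Binary.Definitions using (tri<; tri≈; tri>)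
open import Relation.Binary.PropositionalEquality hiding ([_])
open import Relation.Nullary using (yes; no)

private
  variable
    A B : Set

≤ᵇ-true : ∀ {m n} → m ≤ n → (m ≤ᵇ n) ≡ true
≤ᵇ-true = Equivalence.to T-≡ ∘ ≤⇒≤ᵇ

≤ᵇ-false : ∀ {m n} → n < m → (m ≤ᵇ n) ≡ false
≤ᵇ-false {m} {n} n<m with m ≤ᵇ n in eq
... | false = refl
... | true  = ⊥-elim (<⇒≱ n<m (≤ᵇ⇒≤ m n (Equivalence.from T-≡ eq)))

∧-trueˡ : ∀ a {b} → (a ∧ b) ≡ true → a ≡ true
∧-trueˡ true _ = refl

∧-trueʳ : ∀ a {b} → (a ∧ b) ≡ true → b ≡ true
∧-trueʳ true h = h

⇒-false : ∀ {a b} → (a ≡ true → b ≡ true) → b ≡ false → a ≡ false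
⇒-false {false} _   _     = refl
⇒-false {true}  a⇒b b≡false with () ← trans (sym (a⇒b refl)) b≡false

≡ᵇ-refl : ∀ m → (m ≡ᵇ m) ≡ true
≡ᵇ-refl m = Equivalence.to T-≡ (≡⇒≡ᵇ m m refl)

≡ᵇ-false : ∀ {m n} → m ≢ n → (m ≡ᵇ n) ≡ false
≡ᵇ-false {m} {n} m≢n with m ≡ᵇ n in eq
... | false = refl
... | true  = ⊥-elim (m≢n (≡ᵇ⇒≡ m n (Equivalence.from T-≡ eq)))

toℕ : Bool → ℕ
toℕ true  = 1
toℕ false = 0

toℕ-∧ : ∀ a {x y z} → toℕ x ≡ toℕ y + toℕ z → toℕ (a ∧ x) ≡ toℕ (a ∧ y) + toℕ (a ∧ z)
toℕ-∧ true  h = h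
toℕ-∧ false _ = refl

count : (A → Bool) → List A → ℕ
count p xs = length (filterᵇ p xs)

count-∷ : ∀ (p : A → Bool) x xs → count p (x ∷ xs) ≡ toℕ (p x) + count p xs
count-∷ p x xs with p x
... | true  = refl
... | false = refl

count-++ : ∀ (p : A → Bool) xs ys → count p (xs ++ ys) ≡ count p xs + count p ys
count-++ p xs ys = trans (cong length (filter-++ _ xs ys)) (length-++ (filterᵇ p xs))

count-map : ∀ (p : A → Bool) (f : B → A) xs → count p (map f xs) ≡ count (p ∘ f) xs
count-map p f []       = refl
count-map p f (x ∷ xs) rewrite count-∷ p (f x) (map f xs) | count-∷ (p ∘ f) x xs
  = cong (toℕ (p (f x)) +_) (count-map p f xs)

count-cong : ∀ {p q : A → Bool} → (∀ x → p x ≡ q x) → ∀ xs → count p xs ≡ count q xs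
count-cong p≗q []       = refl
count-cong {p = p} {q} p≗q (x ∷ xs) rewrite count-∷ p x xs | count-∷ q x xs | p≗q x
  = cong (toℕ (q x) +_) (count-cong p≗q xs)

count-none : ∀ (p : A → Bool) xs → All (λ x → p x ≡ false) xs → count p xs ≡ 0
count-none p []       []         = refl
count-none p (x ∷ xs) (px ∷ pxs) rewrite count-∷ p x xs | px = count-none p xs pxs

count-split : ∀ (p q r : A → Bool) → (∀ x → toℕ (p x) ≡ toℕ (q x) + toℕ (r x)) →
              ∀ xs → count p xs ≡ count q xs + count r xs
count-split p q r split []       = refl
count-split p q r split (x ∷ xs)
  rewrite count-∷ p x xs | count-∷ q x xs | count-∷ r x xs | split x | count-split p q r split xs
  = interchange (toℕ (q x)) (toℕ (r x)) (count q xs) (count r xs)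

count-concat : ∀ (p : A → Bool) xss → count p (concat xss) ≡ sum (map (count p) xss)
count-concat p []         = refl
count-concat p (xs ∷ xss) = trans (count-++ p xs (concat xss)) (cong (count p xs +_) (count-concat p xss))

sumTo : (ℕ → ℕ) → ℕ → ℕ
sumTo f M = sum (applyUpTo f M)

sumTo-cong : ∀ {f g} M → (∀ {x} → x < M → f x ≡ g x) → sumTo f M ≡ sumTo g M
sumTo-cong zero    f≗g = refl
sumTo-cong (suc M) f≗g = cong₂ _+_ (f≗g z<s) (sumTo-cong M (f≗g ∘ s<s))

sumTo-const : ∀ c M → sumTo (λ _ → c) M ≡ M * c
sumTo-const c zero    = refl
sumTo-const c (suc M) = cong (c +_) (sumTo-const c M)

sumTo-zero : ∀ {f} M → (∀ {x} → x < M → f x ≡ 0) → sumTo f M ≡ 0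
sumTo-zero M f≡0 = trans (sumTo-cong M f≡0) (trans (sumTo-const 0 M) (*-zeroʳ M))

sumTo-vanishing : ∀ {f} B M → B ≤ M → (∀ {x} → B ≤ x → f x ≡ 0) → sumTo f M ≡ sumTo f B
sumTo-vanishing zero    M       _         f≡0 = sumTo-zero M (λ _ → f≡0 z≤n)
sumTo-vanishing {f} (suc B) (suc M) (s≤s B≤M) f≡0 =
  cong (f 0 +_) (sumTo-vanishing B M B≤M (f≡0 ∘ s≤s))

sumTo-single : ∀ {f} c M → c < M → (∀ {x} → x ≢ c → f x ≡ 0) → sumTo f M ≡ f c
sumTo-single {f} zero (suc M) _ f≡0 =
  trans (cong (f 0 +_) (sumTo-zero M (λ _ → f≡0 (λ ())))) (+-identityʳ (f 0))
sumTo-single (suc c) (suc M) (s≤s c<M) f≡0 rewrite f≡0 {0} (λ ()) =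
  sumTo-single c M c<M (λ x≢c → f≡0 (x≢c ∘ suc-injective))

sumTo-telescope : ∀ M (c h : ℕ → ℕ) → (∀ i → h i ≡ c i + h (suc i)) → sumTo c M + h M ≡ h 0
sumTo-telescope zero    c h step = refl
sumTo-telescope (suc M) c h step = begin
  c 0 + sumTo (c ∘ suc) M + h (suc M)   ≡⟨ +-assoc (c 0) _ _ ⟩
  c 0 + (sumTo (c ∘ suc) M + h (suc M)) ≡⟨ cong (c 0 +_) (sumTo-telescope M (c ∘ suc) (h ∘ suc) (step ∘ suc)) ⟩
  c 0 + h 1                             ≡⟨ step 0 ⟨
  h 0                                   ∎
  where open ≡-Reasoning

words-length : ∀ n M → All (λ w → length w ≡ n) (words n M)
words-length zero    M = refl ∷ []
words-length (suc n) M =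
  All.concat⁺ (All.map⁺ (All.universal (λ a → All.map⁺ (All.map (cong suc) (words-length n M))) (oneTo M)))

count-words-suc : ∀ (p : List ℕ → Bool) n M →
  count p (words (suc n) M) ≡ sumTo (λ x → count (p ∘ (suc x ∷_)) (words n M)) M
count-words-suc p n M = begin
  count p (concat (map extend (oneTo M)))             ≡⟨ count-concat p (map extend (oneTo M)) ⟩
  sum (map (count p) (map extend (oneTo M)))          ≡⟨ cong sum (map-∘ (oneTo M)) ⟨
  sum (map (count p ∘ extend) (map suc (upTo M)))     ≡⟨ cong (sum ∘ map (count p ∘ extend)) (map-upTo suc M) ⟩
  sum (map (count p ∘ extend) (applyUpTo suc M))      ≡⟨ cong sum (map-applyUpTo suc (count p ∘ extend) M) ⟩
  sumTo (count p ∘ extend ∘ suc) M                    ≡⟨ sumTo-cong M (λ {x} _ → count-map p (suc x ∷_) (words n M)) ⟩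
  sumTo (λ x → count (p ∘ (suc x ∷_)) (words n M)) M ∎
  where
  open ≡-Reasoning
  extend : ℕ → List (List ℕ)
  extend a = map (a ∷_) (words n M)

count-words-prefix : ∀ (p : List ℕ → Bool) w r M → All (λ c → 1 ≤ c × c ≤ M) w →
  (∀ π → p π ≡ true → ∃[ τ ] π ≡ w ++ τ) →
  count p (words (length w + r) M) ≡ count (p ∘ (w ++_)) (words r M)
count-words-prefix p []          r M []                        prefixed = refl
count-words-prefix p (suc c ∷ w) r M ((s≤s z≤n , c<M) ∷ w-ok) prefixed = begin
  count p (words (suc (length w + r)) M)                      ≡⟨ count-words-suc p (length w + r) M ⟩
  sumTo (λ x → count (p ∘ (suc x ∷_)) (words (length w + r) M)) M ≡⟨ sumTo-single c M c<M other-head ⟩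
  count (p ∘ (suc c ∷_)) (words (length w + r) M)            ≡⟨ count-words-prefix _ w r M w-ok tail-prefixed ⟩
  count (p ∘ (suc c ∷_) ∘ (w ++_)) (words r M)               ∎
  where
  open ≡-Reasoning
  other-head : ∀ {x} → x ≢ c → count (p ∘ (suc x ∷_)) (words (length w + r) M) ≡ 0
  other-head {x} x≢c = count-none (p ∘ (suc x ∷_)) (words (length w + r) M) (All.universal
    (λ σ → ¬-not (λ pσ → x≢c (suc-injective (∷-injectiveˡ (proj₂ (prefixed (suc x ∷ σ) pσ)))))) _)
  tail-prefixed : ∀ σ → p (suc c ∷ σ) ≡ true → ∃[ τ ] σ ≡ w ++ τ
  tail-prefixed σ pσ with prefixed _ pσ
  ... | τ , refl = τ , refl

count-words-alphabet : ∀ (q : List ℕ → Bool) r B M₁ M₂ → B ≤ M₁ → B ≤ M₂ →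
  (∀ σ → length σ ≡ r → q σ ≡ true → All (_≤ B) σ) →
  count q (words r M₁) ≡ count q (words r M₂)
count-words-alphabet q zero    B M₁ M₂ _    _    _       = refl
count-words-alphabet q (suc r) B M₁ M₂ B≤M₁ B≤M₂ bounded = begin
  count q (words (suc r) M₁)  ≡⟨ count-words-suc q r M₁ ⟩
  sumTo (headed M₁) M₁        ≡⟨ sumTo-vanishing B M₁ B≤M₁ (large-head M₁) ⟩
  sumTo (headed M₁) B         ≡⟨ sumTo-cong B (λ {x} _ → count-words-alphabet (q ∘ (suc x ∷_)) r B M₁ M₂ B≤M₁ B≤M₂
                                                 (λ σ |σ| qσ → All.tail (bounded _ (cong suc |σ|) qσ))) ⟩
  sumTo (headed M₂) B         ≡⟨ sumTo-vanishing B M₂ B≤M₂ (large-head M₂) ⟨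
  sumTo (headed M₂) M₂        ≡⟨ count-words-suc q r M₂ ⟨
  count q (words (suc r) M₂)  ∎
  where
  open ≡-Reasoning
  headed : ℕ → ℕ → ℕ
  headed M x = count (q ∘ (suc x ∷_)) (words r M)
  large-head : ∀ M {x} → B ≤ x → headed M x ≡ 0
  large-head M {x} B≤x = count-none (q ∘ (suc x ∷_)) (words r M) (All.map
    (λ |σ| → ¬-not (λ qσ → <⇒≱ (s≤s B≤x) (All.head (bounded _ (cong suc |σ|) qσ))))
    (words-length r M))

eqList-refl : ∀ xs → eqList xs xs ≡ true
eqList-refl []       = refl
eqList-refl (x ∷ xs) rewrite ≡ᵇ-refl x = eqList-refl xs

eqList-sound : ∀ xs ys → eqList xs ys ≡ true → xs ≡ ys
eqList-sound []       []       _ = refl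
eqList-sound (x ∷ xs) (y ∷ ys) h with x ≡ᵇ y in x≡ᵇy
... | true = cong₂ _∷_ (≡ᵇ⇒≡ x y (Equivalence.from T-≡ x≡ᵇy)) (eqList-sound xs ys h)

eqList-++ˡ : ∀ ws {xs ys} → eqList (ws ++ xs) (ws ++ ys) ≡ eqList xs ys
eqList-++ˡ []       = refl
eqList-++ˡ (w ∷ ws) rewrite ≡ᵇ-refl w = eqList-++ˡ ws

take-length-++ : ∀ (xs ys : List A) {n} → length xs ≡ n → take n (xs ++ ys) ≡ xs
take-length-++ []       ys refl = refl
take-length-++ (x ∷ xs) ys refl = cong (x ∷_) (take-length-++ xs ys refl)

drop-length-++ : ∀ (xs ys : List A) {n} → length xs ≡ n → drop n (xs ++ ys) ≡ ys
drop-length-++ []       ys refl = refl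
drop-length-++ (x ∷ xs) ys refl = drop-length-++ xs ys refl

length-oneTo : ∀ ℓ → length (oneTo ℓ) ≡ ℓ
length-oneTo ℓ = trans (length-map suc (upTo ℓ)) (length-applyUpTo id ℓ)

oneTo-suc : ∀ ℓ → oneTo (suc ℓ) ≡ oneTo ℓ ++ [ suc ℓ ]
oneTo-suc ℓ = trans (cong (map suc) (sym (upTo-∷ʳ ℓ))) (map-++ suc (upTo ℓ) [ ℓ ])

oneTo-suc-++ : ∀ ℓ τ → oneTo (suc ℓ) ++ τ ≡ oneTo ℓ ++ suc ℓ ∷ τ
oneTo-suc-++ ℓ τ = trans (cong (_++ τ) (oneTo-suc ℓ)) (++-assoc (oneTo ℓ) [ suc ℓ ] τ)

length-oneTo-++ : ∀ ℓ τ → length (oneTo ℓ ++ τ) ≡ ℓ + length τ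
length-oneTo-++ ℓ τ = trans (length-++ (oneTo ℓ)) (cong (_+ length τ) (length-oneTo ℓ))

startsWith : ℕ → List ℕ → Bool
startsWith ℓ π = (ℓ ≤ᵇ length π) ∧ eqList (take ℓ π) (oneTo ℓ)

startsWith-++ : ∀ ℓ τ → startsWith ℓ (oneTo ℓ ++ τ) ≡ true
startsWith-++ ℓ τ
  rewrite length-oneTo-++ ℓ τ | ≤ᵇ-true (m≤m+n ℓ (length τ)) | take-length-++ (oneTo ℓ) τ (length-oneTo ℓ)
  = eqList-refl (oneTo ℓ)

startsWith-sound : ∀ ℓ π → startsWith ℓ π ≡ true → ∃[ τ ] π ≡ oneTo ℓ ++ τ
startsWith-sound ℓ π h = drop ℓ π , (begin
  π                          ≡⟨ take++drop≡id ℓ π ⟨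
  take ℓ π ++ drop ℓ π       ≡⟨ cong (_++ drop ℓ π) (eqList-sound _ _ (∧-trueʳ (ℓ ≤ᵇ length π) h)) ⟩
  oneTo ℓ ++ drop ℓ π        ∎)
  where open ≡-Reasoning

startsWith-pred : ∀ ℓ π → startsWith (suc ℓ) π ≡ true → startsWith ℓ π ≡ true
startsWith-pred ℓ π h with startsWith-sound (suc ℓ) π h
... | τ , refl = subst (λ π → startsWith ℓ π ≡ true) (sym (oneTo-suc-++ ℓ τ)) (startsWith-++ ℓ (suc ℓ ∷ τ))

startsWith-suc-[] : ∀ ℓ → startsWith (suc ℓ) (oneTo ℓ ++ []) ≡ false
startsWith-suc-[] ℓ rewrite length-oneTo-++ ℓ [] | +-identityʳ ℓ | ≤ᵇ-false (n<1+n ℓ) = refl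

startsWith-suc-∷ : ∀ ℓ a τ → startsWith (suc ℓ) (oneTo ℓ ++ a ∷ τ) ≡ (a ≡ᵇ suc ℓ)
startsWith-suc-∷ ℓ a τ
  rewrite length-oneTo-++ ℓ (a ∷ τ) | +-suc ℓ (length τ) | ≤ᵇ-true (s≤s (m≤m+n ℓ (length τ)))
        | sym (++-assoc (oneTo ℓ) [ a ] τ) | take-length-++ (oneTo ℓ ++ [ a ]) τ (trans (length-oneTo-++ ℓ [ a ]) (+-comm ℓ 1))
        | oneTo-suc ℓ | eqList-++ˡ (oneTo ℓ) {[ a ]} {[ suc ℓ ]}
  = ∧-identityʳ (a ≡ᵇ suc ℓ)

isIncreasing⇒startsWith : ∀ ℓ π → isIncreasing ℓ π ≡ true → startsWith ℓ π ≡ true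
isIncreasing⇒startsWith ℓ π h with ℓ ≤ᵇ length π | eqList (take ℓ π) (oneTo ℓ)
... | true | true = refl

isIncreasing-[] : ∀ ℓ → isIncreasing ℓ (oneTo ℓ ++ []) ≡ true
isIncreasing-[] ℓ
  rewrite length-oneTo-++ ℓ [] | ≤ᵇ-true (m≤m+n ℓ 0) | take-length-++ (oneTo ℓ) [] (length-oneTo ℓ)
        | eqList-refl (oneTo ℓ) | drop-length-++ (oneTo ℓ) [] (length-oneTo ℓ)
  = refl

isIncreasing-∷ : ∀ ℓ a τ → isIncreasing ℓ (oneTo ℓ ++ a ∷ τ) ≡ not (a ≡ᵇ suc ℓ)
isIncreasing-∷ ℓ a τ
  rewrite length-oneTo-++ ℓ (a ∷ τ) | ≤ᵇ-true (m≤m+n ℓ (length (a ∷ τ)))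
        | take-length-++ (oneTo ℓ) (a ∷ τ) (length-oneTo ℓ)
        | eqList-refl (oneTo ℓ) | drop-length-++ (oneTo ℓ) (a ∷ τ) (length-oneTo ℓ)
  = refl

toℕ-startsWith : ∀ ℓ π →
  toℕ (startsWith ℓ π) ≡ toℕ (isIncreasing ℓ π) + toℕ (startsWith (suc ℓ) π)
toℕ-startsWith ℓ π with startsWith ℓ π in prefixed
... | false rewrite ⇒-false (isIncreasing⇒startsWith ℓ π) prefixed
                  | ⇒-false (startsWith-pred ℓ π) prefixed = refl
... | true with startsWith-sound ℓ π prefixed
...   | [] , refl rewrite isIncreasing-[] ℓ | startsWith-suc-[] ℓ = refl
...   | a ∷ τ , refl rewrite isIncreasing-∷ ℓ a τ | startsWith-suc-∷ ℓ a τ with a ≡ᵇ suc ℓ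
...     | true  = refl
...     | false = refl

startsWith-short : ∀ ℓ π → length π < ℓ → startsWith ℓ π ≡ false
startsWith-short ℓ π |π|<ℓ rewrite ≤ᵇ-false |π|<ℓ = refl

isIncreasing-short : ∀ ℓ π → length π < ℓ → isIncreasing ℓ π ≡ false
isIncreasing-short ℓ π |π|<ℓ rewrite ≤ᵇ-false |π|<ℓ = refl

count-oneTo-prefix : ∀ (q : List ℕ → Bool) ℓ r M → ℓ ≤ M →
  (∀ π → q π ≡ true → ∃[ τ ] π ≡ oneTo ℓ ++ τ) →
  count q (words (ℓ + r) M) ≡ count (q ∘ (oneTo ℓ ++_)) (words r M)
count-oneTo-prefix q ℓ r M ℓ≤M prefixed =
  subst (λ m → count q (words (m + r) M) ≡ count (q ∘ (oneTo ℓ ++_)) (words r M)) (length-oneTo ℓ)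
    (count-words-prefix q (oneTo ℓ) r M letters prefixed)
  where
  letters : All (λ c → 1 ≤ c × c ≤ M) (oneTo ℓ)
  letters = subst (All _) (sym (map-upTo suc ℓ)) (All.applyUpTo⁺₁ suc ℓ (λ i<ℓ → s≤s z≤n , ≤-trans i<ℓ ℓ≤M))

-- Occurrences of 12⋯k12

∈-subseqs⁻ : ∀ π {s} → s ∈ subseqs π → s ⊆ π
∈-subseqs⁻ []      (here refl) = []
∈-subseqs⁻ (x ∷ π) s∈ with ∈-++⁻ (map (x ∷_) (subseqs π)) s∈
... | inj₂ s∈skip = x ∷ʳ ∈-subseqs⁻ π s∈skip
... | inj₁ s∈keep with ∈-map⁻ (x ∷_) s∈keep
...   | s , s∈ , refl = refl ∷ ∈-subseqs⁻ π s∈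

∈-subseqs⁺ : ∀ {s π} → s ⊆ π → s ∈ subseqs π
∈-subseqs⁺ []                     = here refl
∈-subseqs⁺ {π = _ ∷ π} (x ∷ʳ s⊆π) = ∈-++⁺ʳ (map (x ∷_) (subseqs π)) (∈-subseqs⁺ s⊆π)
∈-subseqs⁺ (_∷_ {x} refl s⊆π)     = ∈-++⁺ˡ (∈-map⁺ (x ∷_) (∈-subseqs⁺ s⊆π))

contains-sound : ∀ π τ → contains π τ ≡ true → ∃[ s ] s ⊆ π × reduce s ≡ τ
contains-sound π τ h with find (any⁻ _ (subseqs π) (Equivalence.from T-≡ h))
... | s , s∈ , match = s , ∈-subseqs⁻ π s∈ , eqList-sound _ _ (Equivalence.to T-≡ match)

contains-complete : ∀ {π τ} s → s ⊆ π → reduce s ≡ τ → contains π τ ≡ true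
contains-complete s s⊆π refl = Equivalence.to T-≡
  (any⁺ _ (lose (∈-subseqs⁺ s⊆π) (Equivalence.from T-≡ (eqList-refl (reduce s)))))

contains-length : ∀ π τ → contains π τ ≡ true → length τ ≤ length π
contains-length π τ h with contains-sound π τ h
... | s , s⊆π , refl = subst (_≤ length π) (sym (length-map _ s)) (length-mono-≤ s⊆π)

⊆-++-split : ∀ u {w s} → s ⊆ u ++ w → ∃₂ λ s₁ s₂ → s ≡ s₁ ++ s₂ × s₁ ⊆ u × s₂ ⊆ w
⊆-++-split []      s⊆w = [] , _ , refl , [] , s⊆w
⊆-++-split (x ∷ u) (x ∷ʳ s⊆) with ⊆-++-split u s⊆
... | s₁ , s₂ , refl , s₁⊆u , s₂⊆w = s₁ , s₂ , refl , x ∷ʳ s₁⊆u , s₂⊆w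
⊆-++-split (x ∷ u) (refl ∷ s⊆) with ⊆-++-split u s⊆
... | s₁ , s₂ , refl , s₁⊆u , s₂⊆w = x ∷ s₁ , s₂ , refl , refl ∷ s₁⊆u , s₂⊆w

∷ʳ-⊆-sorted : ∀ {a xs ys} → AllPairs _<_ ys → a ∈ ys → xs ⊆ ys → All (_< a) xs → xs ++ [ a ] ⊆ ys
∷ʳ-⊆-sorted {xs = []}    {y ∷ ys} _ (here refl) _ _ = refl ∷ minimum ys
∷ʳ-⊆-sorted {xs = x ∷ _} {y ∷ ys} (y<ys ∷ _) (here refl) xs⊆ (x<y ∷ _) with lookup {P = x ≡_} xs⊆ (here refl)
... | here refl  = ⊥-elim (<-irrefl refl x<y)
... | there x∈ys = ⊥-elim (<-asym x<y (All.lookup y<ys x∈ys))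
∷ʳ-⊆-sorted (_ ∷ sorted) (there a∈ys) (y ∷ʳ xs⊆)   xs<a         = y ∷ʳ ∷ʳ-⊆-sorted sorted a∈ys xs⊆ xs<a
∷ʳ-⊆-sorted (_ ∷ sorted) (there a∈ys) (refl ∷ xs⊆) (_ ∷ xs<a) = refl ∷ ∷ʳ-⊆-sorted sorted a∈ys xs⊆ xs<a

∈-++-prefix : ∀ (u : List ℕ) {b w v z} → u ++ b ∷ w ≡ v ++ z → length u < length v → b ∈ v
∈-++-prefix []      {v = y ∷ v} eq _        = here (∷-injectiveˡ eq)
∈-++-prefix (x ∷ u) {v = y ∷ v} eq (s≤s lt) = there (∈-++-prefix u (∷-injectiveʳ eq) lt)

sorted-prefix-below : ∀ (u : List ℕ) {b w v z} → AllPairs _<_ v →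
  u ++ b ∷ w ≡ v ++ z → length u < length v → All (_< b) u
sorted-prefix-below []      _                  _  _        = []
sorted-prefix-below (x ∷ u) {v = y ∷ v} (y<v ∷ sorted) eq (s≤s lt) with ∷-injective eq
... | refl , eq′ = All.lookup y<v (∈-++-prefix u eq′ lt) ∷ sorted-prefix-below u sorted eq′ lt

oneTo-sorted : ∀ ℓ → AllPairs _<_ (oneTo ℓ)
oneTo-sorted ℓ = subst (AllPairs _<_) (sym (map-upTo suc ℓ)) (AllPairs.applyUpTo⁺₁ suc ℓ (λ i<j _ → s≤s i<j))

∈-oneTo : ∀ {x ℓ} → x < ℓ → suc x ∈ oneTo ℓ
∈-oneTo {ℓ = ℓ} x<ℓ = subst (_ ∈_) (sym (map-upTo suc ℓ)) (∈-applyUpTo⁺ suc x<ℓ)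

upTo-⊆ : ∀ {m} n → m ≤ n → upTo m ⊆ upTo n
upTo-⊆ zero    z≤n   = []
upTo-⊆ (suc n) m≤1+n with m≤n⇒m<n∨m≡n m≤1+n
... | inj₂ refl  = ⊆-refl
... | inj₁ m<1+n = subst (upTo _ ⊆_) (upTo-∷ʳ n) (++⁺ʳ [ n ] (upTo-⊆ n (≤-pred m<1+n)))

rank : List ℕ → ℕ → ℕ
rank s a = suc (length (filterᵇ (λ b → occurs b s) (upTo a)))

rank-mono : ∀ s {a b} → a ≤ b → rank s a ≤ rank s b
rank-mono s {b = b} a≤b = s≤s (length-mono-≤ (filter⁺ _ _ (λ { refl t → t }) (upTo-⊆ b a≤b)))

rank-reflects-< : ∀ s {a b} → rank s a < rank s b → a < b
rank-reflects-< s ra<rb = ≰⇒> (λ b≤a → <⇒≱ ra<rb (rank-mono s b≤a))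

occurrence-delete : ∀ k ℓ a σ {s} → ℓ < k → a ∈ oneTo ℓ →
  s ⊆ oneTo ℓ ++ a ∷ σ → reduce s ≡ pat k → s ⊆ oneTo ℓ ++ σ
occurrence-delete k ℓ a σ ℓ<k a∈ s⊆ reduced with ⊆-++-split (oneTo ℓ) s⊆
... | s₁ , s₂ , refl , s₁⊆ , _ ∷ʳ s₂⊆ = ++⁺ s₁⊆ s₂⊆
... | s₁ , a ∷ s₃ , refl , s₁⊆ , refl ∷ s₃⊆ =
  subst (_⊆ oneTo ℓ ++ σ) (++-assoc s₁ [ a ] s₃) (++⁺ (∷ʳ-⊆-sorted (oneTo-sorted ℓ) a∈ s₁⊆ s₁<a) s₃⊆)
  where
  ρ : ℕ → ℕ
  ρ = rank (s₁ ++ a ∷ s₃)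
  |s₁|<k : length (map ρ s₁) < length (oneTo k)
  |s₁|<k = subst₂ _<_ (sym (length-map ρ s₁)) (sym (length-oneTo k))
    (≤-<-trans (subst (length s₁ ≤_) (length-oneTo ℓ) (length-mono-≤ s₁⊆)) ℓ<k)
  -- the first |s₁| + 1 letters of pat k increase, because |s₁| ≤ ℓ < k
  s₁<a : All (_< a) s₁
  s₁<a = All.map (rank-reflects-< (s₁ ++ a ∷ s₃)) (All.map⁻
    (sorted-prefix-below (map ρ s₁) (oneTo-sorted k) (trans (sym (map-++ ρ s₁ (a ∷ s₃))) reduced) |s₁|<k))

contains-delete : ∀ k ℓ a σ → ℓ < k → a ∈ oneTo ℓ →
  contains (oneTo ℓ ++ a ∷ σ) (pat k) ≡ contains (oneTo ℓ ++ σ) (pat k)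
contains-delete k ℓ a σ ℓ<k a∈ = ⇔→≡ {z = true} (mk⇔ delete insert)
  where
  delete : contains (oneTo ℓ ++ a ∷ σ) (pat k) ≡ true → contains (oneTo ℓ ++ σ) (pat k) ≡ true
  delete h with contains-sound (oneTo ℓ ++ a ∷ σ) (pat k) h
  ... | s , s⊆ , reduced = contains-complete s (occurrence-delete k ℓ a σ ℓ<k a∈ s⊆ reduced) reduced
  insert : contains (oneTo ℓ ++ σ) (pat k) ≡ true → contains (oneTo ℓ ++ a ∷ σ) (pat k) ≡ true
  insert h with contains-sound (oneTo ℓ ++ σ) (pat k) h
  ... | s , s⊆ , reduced = contains-complete s (⊆-trans s⊆ (++⁺ (⊆-refl {oneTo ℓ}) (a ∷ʳ ⊆-refl))) reduced

isCanonicalFrom-old : ∀ {ℓ x} σ → x < ℓ → isCanonicalFrom ℓ (suc x ∷ σ) ≡ isCanonicalFrom ℓ σ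
isCanonicalFrom-old σ x<ℓ rewrite ≤ᵇ-true (m≤n⇒m≤1+n x<ℓ) | m≥n⇒m⊔n≡m x<ℓ = refl

isCanonicalFrom-new : ∀ ℓ σ → isCanonicalFrom ℓ (suc ℓ ∷ σ) ≡ isCanonicalFrom (suc ℓ) σ
isCanonicalFrom-new ℓ σ rewrite ≤ᵇ-true (≤-refl {suc ℓ}) | m≤n⇒m⊔n≡n (n≤1+n ℓ) = refl

isCanonicalFrom-jump : ∀ {ℓ x} σ → ℓ < x → isCanonicalFrom ℓ (suc x ∷ σ) ≡ false
isCanonicalFrom-jump σ ℓ<x rewrite ≤ᵇ-false (s≤s ℓ<x) = refl

isCanonicalFrom-bound : ∀ mx σ → isCanonicalFrom mx σ ≡ true → All (_≤ mx + length σ) σ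
isCanonicalFrom-bound mx []      _ = []
isCanonicalFrom-bound mx (a ∷ σ) h with 1 ≤ᵇ a | a ≤ᵇ suc mx in a≤ᵇ
... | true | true = subst (λ B → All (_≤ B) (a ∷ σ)) (sym (+-suc mx (length σ)))
  (≤-trans a≤1+mx (m≤m+n (suc mx) (length σ)) ∷
   All.map (λ b≤ → ≤-trans b≤ (+-monoˡ-≤ (length σ) (⊔-lub (n≤1+n mx) a≤1+mx)))
           (isCanonicalFrom-bound (mx ⊔ a) σ h))
  where
  a≤1+mx : a ≤ suc mx
  a≤1+mx = ≤ᵇ⇒≤ a (suc mx) (Equivalence.from T-≡ a≤ᵇ)

isCanonical-oneTo-++ : ∀ ℓ τ → isCanonical (oneTo ℓ ++ τ) ≡ isCanonicalFrom ℓ τ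
isCanonical-oneTo-++ zero    τ = refl
isCanonical-oneTo-++ (suc ℓ) τ = begin
  isCanonical (oneTo (suc ℓ) ++ τ)    ≡⟨ cong isCanonical (oneTo-suc-++ ℓ τ) ⟩
  isCanonical (oneTo ℓ ++ suc ℓ ∷ τ)  ≡⟨ isCanonical-oneTo-++ ℓ (suc ℓ ∷ τ) ⟩
  isCanonicalFrom ℓ (suc ℓ ∷ τ)       ≡⟨ isCanonicalFrom-new ℓ τ ⟩
  isCanonicalFrom (suc ℓ) τ           ∎
  where open ≡-Reasoning

-- Avoiding partitions counted by their increasing prefix

avoiding : ℕ → (List ℕ → Bool) → List ℕ → Bool
avoiding k q π = isCanonical π ∧ not (contains π (pat k)) ∧ q π

avoiding-true : ∀ k q π → avoiding k q π ≡ true → q π ≡ true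
avoiding-true k q π h = ∧-trueʳ (not (contains π (pat k))) (∧-trueʳ (isCanonical π) h)

avoiding-false : ∀ k q π → q π ≡ false → avoiding k q π ≡ false
avoiding-false k q π qπ rewrite qπ | ∧-zeroʳ (not (contains π (pat k))) = ∧-zeroʳ (isCanonical π)

avoiding-startsWith-prefix : ∀ k ℓ π → avoiding k (startsWith ℓ) π ≡ true → ∃[ τ ] π ≡ oneTo ℓ ++ τ
avoiding-startsWith-prefix k ℓ π = startsWith-sound ℓ π ∘ avoiding-true k (startsWith ℓ) π

avoiding-isIncreasing-prefix : ∀ k ℓ π → avoiding k (isIncreasing ℓ) π ≡ true → ∃[ τ ] π ≡ oneTo ℓ ++ τ
avoiding-isIncreasing-prefix k ℓ π =
  startsWith-sound ℓ π ∘ isIncreasing⇒startsWith ℓ π ∘ avoiding-true k (isIncreasing ℓ) π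

count-avoiding-short : ∀ k q ℓ n → (∀ π → length π < ℓ → q π ≡ false) → n < ℓ →
  count (avoiding k q) (words n n) ≡ 0
count-avoiding-short k q ℓ n short n<ℓ = count-none (avoiding k q) (words n n)
  (All.map (λ {π} |π| → avoiding-false k q π (short π (subst (_< ℓ) (sym |π|) n<ℓ))) (words-length n n))

countP-short : ∀ k ℓ n → n < ℓ → countP k ℓ n ≡ 0
countP-short k ℓ n = count-avoiding-short k (isIncreasing ℓ) ℓ n (isIncreasing-short ℓ)

countPrefixed : ℕ → ℕ → ℕ → ℕ
countPrefixed k ℓ n = count (avoiding k (startsWith ℓ)) (words n n)

countPrefixed-short : ∀ k ℓ n → n < ℓ → countPrefixed k ℓ n ≡ 0
countPrefixed-short k ℓ n = count-avoiding-short k (startsWith ℓ) ℓ n (startsWith-short ℓ)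

countPrefixed-suc : ∀ k ℓ n → countPrefixed k ℓ n ≡ countP k ℓ n + countPrefixed k (suc ℓ) n
countPrefixed-suc k ℓ n = count-split _ _ _
  (λ π → toℕ-∧ (isCanonical π) (toℕ-∧ (not (contains π (pat k))) (toℕ-startsWith ℓ π)))
  (words n n)

G≡countPrefixed : ∀ k ℓ n → G k ℓ n ≡ countPrefixed k ℓ n
G≡countPrefixed k ℓ n = begin
  G k ℓ n                            ≡⟨ cong sum (map-upTo term (suc n)) ⟩
  sumTo term (suc n)                 ≡⟨ +-identityʳ _ ⟨
  sumTo term (suc n) + 0             ≡⟨ cong (sumTo term (suc n) +_) (countPrefixed-short k _ n (m≤n⊔m ℓ (suc n))) ⟨
  sumTo term (suc n) + rest (suc n)  ≡⟨ sumTo-telescope (suc n) term rest step ⟩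
  rest 0                             ≡⟨ cong (λ i → countPrefixed k i n) (⊔-identityʳ ℓ) ⟩
  countPrefixed k ℓ n                ∎
  where
  open ≡-Reasoning
  term : ℕ → ℕ
  term i = if ℓ ≤ᵇ i then F k i n else 0
  -- rest i counts the avoiding words beginning with 12⋯(ℓ ⊔ i); it telescopes against term
  rest : ℕ → ℕ
  rest i = countPrefixed k (ℓ ⊔ i) n
  step : ∀ i → rest i ≡ term i + rest (suc i)
  step i with ℓ ≤? i
  ... | yes ℓ≤i rewrite ≤ᵇ-true ℓ≤i | m≤n⇒m⊔n≡n ℓ≤i | m≤n⇒m⊔n≡n (m≤n⇒m≤1+n ℓ≤i) = countPrefixed-suc k i n
  ... | no ℓ≰i  rewrite ≤ᵇ-false (≰⇒> ℓ≰i) | m≥n⇒m⊔n≡m (<⇒≤ (≰⇒> ℓ≰i)) | m≥n⇒m⊔n≡m (≰⇒> ℓ≰i) = refl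

avoiding-isIncreasing-delete : ∀ k ℓ x σ → ℓ < k → x < ℓ →
  avoiding k (isIncreasing ℓ) (oneTo ℓ ++ suc x ∷ σ) ≡ avoiding k (startsWith ℓ) (oneTo ℓ ++ σ)
avoiding-isIncreasing-delete k ℓ x σ ℓ<k x<ℓ
  rewrite isCanonical-oneTo-++ ℓ (suc x ∷ σ) | isCanonical-oneTo-++ ℓ σ | isCanonicalFrom-old σ x<ℓ
        | contains-delete k ℓ (suc x) σ ℓ<k (∈-oneTo x<ℓ)
        | isIncreasing-∷ ℓ (suc x) σ | ≡ᵇ-false (<⇒≢ (s≤s x<ℓ)) | startsWith-++ ℓ σ
  = refl

avoiding-isIncreasing-large : ∀ k ℓ x σ → ℓ ≤ x → avoiding k (isIncreasing ℓ) (oneTo ℓ ++ suc x ∷ σ) ≡ false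
avoiding-isIncreasing-large k ℓ x σ ℓ≤x with m≤n⇒m<n∨m≡n ℓ≤x
... | inj₁ ℓ<x  rewrite isCanonical-oneTo-++ ℓ (suc x ∷ σ) | isCanonicalFrom-jump σ ℓ<x = refl
... | inj₂ refl = avoiding-false k (isIncreasing ℓ) _ (trans (isIncreasing-∷ ℓ (suc ℓ) σ) (cong not (≡ᵇ-refl (suc ℓ))))

countP-self : ∀ k ℓ → ℓ < k → countP k ℓ ℓ ≡ 1
countP-self k ℓ ℓ<k = begin
  count P (words ℓ ℓ)               ≡⟨ cong (λ m → count P (words m ℓ)) (+-identityʳ ℓ) ⟨
  count P (words (ℓ + 0) ℓ)         ≡⟨ count-oneTo-prefix P ℓ 0 ℓ ≤-refl (avoiding-isIncreasing-prefix k ℓ) ⟩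
  count (P ∘ (oneTo ℓ ++_)) [ [] ]  ≡⟨ count-∷ (P ∘ (oneTo ℓ ++_)) [] [] ⟩
  toℕ (P (oneTo ℓ ++ [])) + 0       ≡⟨ cong (λ b → toℕ b + 0) P-oneTo ⟩
  1                                 ∎
  where
  open ≡-Reasoning
  P : List ℕ → Bool
  P = avoiding k (isIncreasing ℓ)
  shorter : length (oneTo ℓ ++ []) < length (pat k)
  shorter = subst₂ _<_ (sym (trans (length-oneTo-++ ℓ []) (+-identityʳ ℓ)))
    (sym (trans (length-++ (oneTo k)) (cong (_+ 2) (length-oneTo k)))) (≤-trans ℓ<k (m≤m+n k 2))
  P-oneTo : P (oneTo ℓ ++ []) ≡ true
  P-oneTo rewrite isCanonical-oneTo-++ ℓ [] | isIncreasing-[] ℓ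
                | ¬-not (λ h → <⇒≱ shorter (contains-length (oneTo ℓ ++ []) (pat k) h)) = refl

countP-suc : ∀ k ℓ r → ℓ < k → countP k ℓ (suc (ℓ + r)) ≡ ℓ * countPrefixed k ℓ (ℓ + r)
countP-suc k ℓ r ℓ<k = begin
  count P (words n n)                          ≡⟨ cong (λ m → count P (words m n)) (+-suc ℓ r) ⟨
  count P (words (ℓ + suc r) n)                ≡⟨ count-oneTo-prefix P ℓ (suc r) n ℓ≤n (avoiding-isIncreasing-prefix k ℓ) ⟩
  count (P ∘ (oneTo ℓ ++_)) (words (suc r) n)  ≡⟨ count-words-suc (P ∘ (oneTo ℓ ++_)) r n ⟩
  sumTo withNext n                             ≡⟨ sumTo-vanishing ℓ n ℓ≤n withNext-large ⟩
  sumTo withNext ℓ                             ≡⟨ sumTo-cong ℓ withNext-small ⟩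
  sumTo (λ _ → count Q (words r n)) ℓ          ≡⟨ sumTo-const (count Q (words r n)) ℓ ⟩
  ℓ * count Q (words r n)                      ≡⟨ cong (ℓ *_) shrink-alphabet ⟩
  ℓ * count Q (words r (ℓ + r))                ≡⟨ cong (ℓ *_) strip-prefix ⟨
  ℓ * countPrefixed k ℓ (ℓ + r)                ∎
  where
  open ≡-Reasoning
  n : ℕ
  n = suc (ℓ + r)
  ℓ≤n : ℓ ≤ n
  ℓ≤n = m≤n⇒m≤1+n (m≤m+n ℓ r)
  P S Q : List ℕ → Bool
  P = avoiding k (isIncreasing ℓ)
  S = avoiding k (startsWith ℓ)
  Q = S ∘ (oneTo ℓ ++_)
  withNext : ℕ → ℕ
  withNext x = count (λ σ → P (oneTo ℓ ++ suc x ∷ σ)) (words r n)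
  withNext-large : ∀ {x} → ℓ ≤ x → withNext x ≡ 0
  withNext-large {x} ℓ≤x =
    count-none _ (words r n) (All.universal (λ σ → avoiding-isIncreasing-large k ℓ x σ ℓ≤x) _)
  withNext-small : ∀ {x} → x < ℓ → withNext x ≡ count Q (words r n)
  withNext-small {x} x<ℓ = count-cong (λ σ → avoiding-isIncreasing-delete k ℓ x σ ℓ<k x<ℓ) (words r n)
  -- the shortened words still range over the alphabet [1, n]; canonicity bounds them by ℓ + r
  bounded : ∀ σ → length σ ≡ r → Q σ ≡ true → All (_≤ ℓ + r) σ
  bounded σ refl h = isCanonicalFrom-bound ℓ σ
    (trans (sym (isCanonical-oneTo-++ ℓ σ)) (∧-trueˡ (isCanonical (oneTo ℓ ++ σ)) h))
  shrink-alphabet : count Q (words r n) ≡ count Q (words r (ℓ + r))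
  shrink-alphabet = count-words-alphabet Q r (ℓ + r) n (ℓ + r) (n≤1+n (ℓ + r)) ≤-refl bounded
  strip-prefix : countPrefixed k ℓ (ℓ + r) ≡ count Q (words r (ℓ + r))
  strip-prefix = count-oneTo-prefix S ℓ r (ℓ + r) (m≤m+n ℓ r) (avoiding-startsWith-prefix k ℓ)

X*G-short : ∀ k ℓ n → n ≤ ℓ → X* (G k ℓ) n ≡ 0
X*G-short k ℓ zero    _   = refl
X*G-short k ℓ (suc m) m<ℓ = trans (G≡countPrefixed k ℓ m) (countPrefixed-short k ℓ m m<ℓ)

Xpow-off : ∀ ℓ n → n ≢ ℓ → Xpow ℓ n ≡ 0
Xpow-off ℓ n n≢ℓ rewrite ≡ᵇ-false n≢ℓ = refl

F-recurrence : ∀ k ℓ → ℓ < k → ∀ n → F k ℓ n ≡ ((ℓ ·ₛ X* (G k ℓ)) ⊕ Xpow ℓ) n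
F-recurrence k ℓ ℓ<k n with <-cmp n ℓ
... | tri< n<ℓ n≢ℓ _
  rewrite X*G-short k ℓ n (<⇒≤ n<ℓ) | Xpow-off ℓ n n≢ℓ | *-zeroʳ ℓ = countP-short k ℓ n n<ℓ
... | tri≈ _ refl _
  rewrite X*G-short k n n ≤-refl | ≡ᵇ-refl n | *-zeroʳ n = countP-self k n ℓ<k
... | tri> _ n≢ℓ ℓ<n with r , refl ← m≤n⇒∃[o]m+o≡n ℓ<n
  rewrite Xpow-off ℓ _ n≢ℓ | +-identityʳ (ℓ * G k ℓ (ℓ + r))
  = trans (countP-suc k ℓ r ℓ<k) (cong (ℓ *_) (sym (G≡countPrefixed k ℓ (ℓ + r))))

-- The recurrence holds for every ℓ < k, including ℓ = 0.
lemma1 : (k ℓ : ℕ) → 2 ≤ k → 1 ≤ ℓ → ℓ ≤ k ∸ 1 →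
    (n : ℕ) → F k ℓ n ≡ ((ℓ ·ₛ X* (G k ℓ)) ⊕ Xpow ℓ) n
lemma1 zero    ℓ () _ _
lemma1 (suc k) ℓ _  _ ℓ≤k = F-recurrence (suc k) ℓ (s≤s ℓ≤k)
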